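{- Let $G$ be an $(X,Y)$-bipartite graph on $n$ vertices with $|Y|\geq |X|> n/4$. If $\delta(X,Y)\geq |Y|-n/8$ and $\delta(Y,X)\geq |X|-n/8$, then in every 2-coloring of the edges of $G$ there exists a monochromatic component $H$ such that $|V(H)\cap X|\geq |X|/2$ and $|V(H)\cap Y|\geq |Y|/2$; in particular $|V(H)|\geq n/2$.
   Context: For an $(X,Y)$-bipartite graph $G$, $\delta(X,Y)$ denotes the minimum degree of a vertex of $X$ (into $Y$), and $\delta(Y,X)$ the minimum degree of a vertex of $Y$ (into $X$). In an edge-colored graph, a monochromatic component is a connected component of the subgraph formed by the edges of a single color. -}

module Defs where

open import Data.Nat using (ℕ)
open import Data.Bool using (Bool; true; false)
open import Data.Fin using (Fin)
open import Data.Fin.Subset using (Subset; ∣_∣)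
open import Data.Sum using (_⊎_; inj₁; inj₂)
open import Data.Vec using (tabulate)
open import Relation.Binary.PropositionalEquality using (_≡_)
open import Relation.Binary.Construct.Closure.ReflexiveTransitive using (Star)

-- An (X,Y)-bipartite graph with |X| = a, |Y| = b is given by its
-- biadjacency matrix  adj : Fin a → Fin b → Bool  (x ~ y iff adj x y ≡ true).
BipGraph : ℕ → ℕ → Set
BipGraph a b = Fin a → Fin b → Bool

Vertex : ℕ → ℕ → Set
Vertex a b = Fin a ⊎ Fin b

degX : ∀ {a b} → BipGraph a b → Fin a → ℕ
degX adj x = ∣ tabulate (λ y → adj x y) ∣

degY : ∀ {a b} → BipGraph a b → Fin b → ℕ
degY adj y = ∣ tabulate (λ x → adj x y) ∣

-- A 2-colouring of the edges: a colour for every pair (only the colours of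
-- actual edges matter).
Colouring : ℕ → ℕ → Set
Colouring a b = Fin a → Fin b → Bool

data MonoEdge {a b : ℕ} (adj : BipGraph a b) (c : Colouring a b) (κ : Bool)
     : Vertex a b → Vertex a b → Set where
  xy : ∀ x y → adj x y ≡ true → c x y ≡ κ → MonoEdge adj c κ (inj₁ x) (inj₂ y)
  yx : ∀ x y → adj x y ≡ true → c x y ≡ κ → MonoEdge adj c κ (inj₂ y) (inj₁ x)

SameComp : ∀ {a b} → BipGraph a b → Colouring a b → Bool → Vertex a b → Vertex a b → Set
SameComp adj c κ = Star (MonoEdge adj c κ)

-- Write n = a + b for |X| = a ≤ b = |Y| with a > n/4, where every vertex misses
-- at most n/8 vertices of the other side.  The proof has three ingredients:
--   * monochromatic components are decidable, so their X- and Y-parts are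
--     finite subsets that can be counted (breadth-first search stabilises);
--   * a "dense pair" (S ⊆ X, T ⊆ Y) all of whose edges have colour μ, with
--     |S| > n/8 and |T| > n/4 (or vice versa), lies in one colour-μ component;
--   * double counting the edges of a bipartite graph.
-- If a component C of colour κ is large on one side, the part of the other
-- side that C misses, together with the large part of C, forms a dense pair of
-- the other colour; repeating this at most three times yields a component
-- containing half of X and half of Y.  If no component is large, all degrees
-- are small, which contradicts the minimum-degree conditions by double counting.
module Submission where

open import Defs
open import Data.Nat using (ℕ; zero; suc; _+_; _*_; _≤_; _<_; z≤n; s≤s; _<?_; _≤?_; NonZero; >-nonZero)
open import Data.Nat.Properties
open import Data.Bool using (Bool; true; false; not; if_then_else_)
import Data.Bool.Properties as Bool
open import Data.Fin using (Fin; zero; suc; fromℕ<; join; splitAt)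
open import Data.Fin.Properties using (any?; splitAt-join)
open import Data.Fin.Subset using (Subset; _∈_; ∣_∣; _∉_; _⊆_; _⊂_; _∪_; _∩_; ∁; Nonempty; ⁅_⁆; inside; outside)
open import Data.Fin.Subset.Properties
  using (_∈?_; nonempty?; Empty-unique; ∣⊥∣≡0; p⊆q⇒∣p∣≤∣q∣; p⊂q⇒∣p∣<∣q∣; ∣∁p∣≡n∸∣p∣; ∣p∣≤n;
         x∈p∩q⁺; x∈p∩q⁻; x∈p∪q⁺; x∉p⇒x∈∁p; x∈∁p⇒x∉p; x∈⁅x⁆; x∈⁅y⁆⇒x≡y)
open import Data.Vec using ([]; _∷_; tabulate)
open import Data.Vec.Properties using ([]=⇒lookup; lookup⇒[]=; lookup∘tabulate)
open import Data.Sum using (_⊎_; inj₁; inj₂; swap)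
open import Data.Product using (∃; ∃-syntax; _×_; _,_)
open import Data.Empty using (⊥; ⊥-elim)
open import Function using (_∘_)
open import Relation.Nullary using (Dec; yes; no; does; ¬_; contradiction)
open import Relation.Nullary.Decidable using (dec-true; _×-dec_; _⊎-dec_; ¬?; map′)
open import Relation.Unary using (Pred; Decidable)
open import Relation.Binary.PropositionalEquality
open import Relation.Binary.Construct.Closure.ReflexiveTransitive using (Star; ε; _◅_; _◅◅_; gmap)
open import Algebra.Properties.CommutativeMonoid.Sum +-0-commutativeMonoid using (sum; ∑-comm; sum-cong-≗)

∈-tabulate⁺ : ∀ {k} {f : Fin k → Bool} {i} → f i ≡ true → i ∈ tabulate f
∈-tabulate⁺ {f = f} {i} fi = lookup⇒[]= i (tabulate f) (trans (lookup∘tabulate f i) fi)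

∈-tabulate⁻ : ∀ {k} {f : Fin k → Bool} {i} → i ∈ tabulate f → f i ≡ true
∈-tabulate⁻ {f = f} {i} i∈ = trans (sym (lookup∘tabulate f i)) ([]=⇒lookup i∈)

select : ∀ {k p} {P : Pred (Fin k) p} → Decidable P → Subset k
select P? = tabulate (λ i → does (P? i))

∈-select⁺ : ∀ {k p} {P : Pred (Fin k) p} (P? : Decidable P) {i} → P i → i ∈ select P?
∈-select⁺ P? {i} Pi = ∈-tabulate⁺ (dec-true (P? i) Pi)

∈-select⁻ : ∀ {k p} {P : Pred (Fin k) p} (P? : Decidable P) {i} → i ∈ select P? → P i
∈-select⁻ P? {i} i∈ with P? i | ∈-tabulate⁻ {f = λ j → does (P? j)} i∈
... | yes Pi | _ = Pi

∣p∪q∣≤∣p∣+∣q∣ : ∀ {k} (p q : Subset k) → ∣ p ∪ q ∣ ≤ ∣ p ∣ + ∣ q ∣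
∣p∪q∣≤∣p∣+∣q∣ []            []            = z≤n
∣p∪q∣≤∣p∣+∣q∣ (outside ∷ p) (outside ∷ q) = ∣p∪q∣≤∣p∣+∣q∣ p q
∣p∪q∣≤∣p∣+∣q∣ (outside ∷ p) (inside ∷ q)  =
  ≤-trans (s≤s (∣p∪q∣≤∣p∣+∣q∣ p q)) (≤-reflexive (sym (+-suc ∣ p ∣ ∣ q ∣)))
∣p∪q∣≤∣p∣+∣q∣ (inside ∷ p)  (outside ∷ q) = s≤s (∣p∪q∣≤∣p∣+∣q∣ p q)
∣p∪q∣≤∣p∣+∣q∣ (inside ∷ p)  (inside ∷ q)  = s≤s (≤-trans (∣p∪q∣≤∣p∣+∣q∣ p q) (+-monoʳ-≤ ∣ p ∣ (n≤1+n ∣ q ∣)))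

cover : ∀ {k} {p q r : Subset k} → p ⊆ q ∪ r → ∣ p ∣ ≤ ∣ q ∣ + ∣ r ∣
cover {q = q} {r} p⊆ = ≤-trans (p⊆q⇒∣p∣≤∣q∣ p⊆) (∣p∪q∣≤∣p∣+∣q∣ q r)

∣p∣+∣∁p∣≡k : ∀ {k} (p : Subset k) → ∣ p ∣ + ∣ ∁ p ∣ ≡ k
∣p∣+∣∁p∣≡k p = trans (cong (∣ p ∣ +_) (∣∁p∣≡n∸∣p∣ p)) (m+[n∸m]≡n (∣p∣≤n p))

size>0⇒nonempty : ∀ {k} (p : Subset k) → 0 < ∣ p ∣ → Nonempty p
size>0⇒nonempty {k} p 0<∣p∣ with nonempty? p
... | yes ne = ne
... | no empty = contradiction (trans (cong ∣_∣ (Empty-unique empty)) (∣⊥∣≡0 k)) (>⇒≢ 0<∣p∣)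

meets : ∀ {k} (p q : Subset k) → ∣ ∁ q ∣ < ∣ p ∣ → Nonempty (p ∩ q)
meets p q ∣∁q∣<∣p∣ = size>0⇒nonempty (p ∩ q) (+-cancelʳ-< (∣ ∁ q ∣) 0 (∣ p ∩ q ∣) (<-≤-trans ∣∁q∣<∣p∣ p≤))
  where
  p≤ : ∣ p ∣ ≤ ∣ p ∩ q ∣ + ∣ ∁ q ∣
  p≤ = cover λ {x} x∈p → x∈p∪q⁺ (split x x∈p)
    where
    split : ∀ x → x ∈ p → x ∈ p ∩ q ⊎ x ∈ ∁ q
    split x x∈p with x ∈? q
    ... | yes x∈q = inj₁ (x∈p∩q⁺ (x∈p , x∈q))
    ... | no x∉q = inj₂ (x∉p⇒x∈∁p x∉q)

∣∁p∩q∣≤ : ∀ {k} (p q : Subset k) → ∣ ∁ (p ∩ q) ∣ ≤ ∣ ∁ p ∣ + ∣ ∁ q ∣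
∣∁p∩q∣≤ p q = cover λ {x} x∈ → x∈p∪q⁺ (split x (x∈∁p⇒x∉p x∈))
  where
  split : ∀ x → x ∉ p ∩ q → x ∈ ∁ p ⊎ x ∈ ∁ q
  split x x∉ with x ∈? p | x ∈? q
  ... | yes x∈p | yes x∈q = contradiction (x∈p∩q⁺ (x∈p , x∈q)) x∉
  ... | no x∉p  | _       = inj₁ (x∉p⇒x∈∁p x∉p)
  ... | yes _   | no x∉q  = inj₂ (x∉p⇒x∈∁p x∉q)

complement-large : ∀ {k} (p : Subset k) → ¬ (k ≤ 2 * ∣ p ∣) → k < 2 * ∣ ∁ p ∣
complement-large {k} p small = +-cancelˡ-< k k (2 * ∣ ∁ p ∣) (begin-strict
  k + k                   ≡⟨ cong (k +_) (+-identityʳ k) ⟨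
  2 * k                   ≡⟨ cong (2 *_) (∣p∣+∣∁p∣≡k p) ⟨
  2 * (∣ p ∣ + ∣ ∁ p ∣)     ≡⟨ *-distribˡ-+ 2 ∣ p ∣ ∣ ∁ p ∣ ⟩
  2 * ∣ p ∣ + 2 * ∣ ∁ p ∣   <⟨ +-monoˡ-< (2 * ∣ ∁ p ∣) (≰⇒> small) ⟩
  k + 2 * ∣ ∁ p ∣           ∎)
  where open ≤-Reasoning

first-or-all : ∀ {k} {A : Set} {P : Fin k → Set} → (∀ i → A ⊎ P i) → A ⊎ (∀ i → P i)
first-or-all {zero}  choice = inj₂ λ ()
first-or-all {suc k} choice with choice zero | first-or-all (λ i → choice (suc i))
... | inj₁ found | _          = inj₁ found
... | inj₂ _     | inj₁ found = inj₁ found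
... | inj₂ P0    | inj₂ Ps    = inj₂ λ { zero → P0 ; (suc i) → Ps i }

-- Each iteration either strictly enlarges the set or reaches a fixed point,
-- and a subset of Fin k cannot grow k + 1 times.
module Stabilisation {k : ℕ} (f : Subset k → Subset k)
  (inflationary : ∀ {P} → P ⊆ f P)
  (monotone : ∀ {P Q} → P ⊆ Q → f P ⊆ f Q) where

  iterate : ℕ → Subset k → Subset k
  iterate zero    P = P
  iterate (suc m) P = f (iterate m P)

  grows-or-stable : ∀ Q → Q ⊂ f Q ⊎ f Q ⊆ Q
  grows-or-stable Q with any? (λ i → i ∈? f Q ×-dec ¬? (i ∈? Q))
  ... | yes new = inj₁ (inflationary , new)
  ... | no nothing-new = inj₂ stays
    where
    stays : f Q ⊆ Q
    stays {i} i∈fQ with i ∈? Q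
    ... | yes i∈Q = i∈Q
    ... | no i∉Q = contradiction (i , i∈fQ , i∉Q) nothing-new

  progress : ∀ m P → m ≤ ∣ iterate m P ∣ ⊎ f (iterate m P) ⊆ iterate m P
  progress zero P = inj₁ z≤n
  progress (suc m) P with progress m P
  ... | inj₂ stable = inj₂ (monotone stable)
  ... | inj₁ m≤ with grows-or-stable (iterate m P)
  ...   | inj₁ grows  = inj₁ (<-≤-trans (s≤s m≤) (p⊂q⇒∣p∣<∣q∣ grows))
  ...   | inj₂ stable = inj₂ (monotone stable)

  stationary : ∀ P → f (iterate (suc k) P) ⊆ iterate (suc k) P
  stationary P with progress (suc k) P
  ... | inj₁ k<∣Q∣ = contradiction (∣p∣≤n (iterate (suc k) P)) (<⇒≱ k<∣Q∣)
  ... | inj₂ stable = stable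

module Reachability {k : ℕ} (_⟶_ : Fin k → Fin k → Set) (_⟶?_ : ∀ i j → Dec (i ⟶ j)) where

  Expands : Subset k → Fin k → Set
  Expands P j = j ∈ P ⊎ ∃ λ i → i ∈ P × i ⟶ j

  expands? : ∀ P j → Dec (Expands P j)
  expands? P j = j ∈? P ⊎-dec any? (λ i → i ∈? P ×-dec i ⟶? j)

  expand : Subset k → Subset k
  expand P = select (expands? P)

  expand-inflationary : ∀ {P} → P ⊆ expand P
  expand-inflationary j∈P = ∈-select⁺ (expands? _) (inj₁ j∈P)

  expand-monotone : ∀ {P Q} → P ⊆ Q → expand P ⊆ expand Q
  expand-monotone P⊆Q j∈ with ∈-select⁻ (expands? _) j∈
  ... | inj₁ j∈P            = ∈-select⁺ (expands? _) (inj₁ (P⊆Q j∈P))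
  ... | inj₂ (i , i∈P , i⟶j) = ∈-select⁺ (expands? _) (inj₂ (i , P⊆Q i∈P , i⟶j))

  open Stabilisation expand expand-inflationary expand-monotone

  reachable : Fin k → Subset k
  reachable i = iterate (suc k) ⁅ i ⁆

  search-sound : ∀ m {i j} → j ∈ iterate m ⁅ i ⁆ → Star _⟶_ i j
  search-sound zero j∈ rewrite x∈⁅y⁆⇒x≡y _ j∈ = ε
  search-sound (suc m) j∈ with ∈-select⁻ (expands? _) j∈
  ... | inj₁ j∈P             = search-sound m j∈P
  ... | inj₂ (l , l∈P , l⟶j) = search-sound m l∈P ◅◅ (l⟶j ◅ ε)

  start∈ : ∀ m i → i ∈ iterate m ⁅ i ⁆
  start∈ zero    i = x∈⁅x⁆ i
  start∈ (suc m) i = expand-inflationary (start∈ m i)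

  closed : ∀ {i j l} → j ∈ reachable i → j ⟶ l → l ∈ reachable i
  closed j∈ j⟶l = stationary _ (∈-select⁺ (expands? _) (inj₂ (_ , j∈ , j⟶l)))

  search-complete : ∀ {i j} → Star _⟶_ i j → j ∈ reachable i
  search-complete {i} path = go path (start∈ (suc k) i)
    where
    go : ∀ {j l} → Star _⟶_ j l → j ∈ reachable i → l ∈ reachable i
    go ε j∈ = j∈
    go (e ◅ es) j∈ = go es (closed j∈ e)

  reachable? : ∀ i j → Dec (Star _⟶_ i j)
  reachable? i j = map′ (search-sound (suc k)) search-complete (j ∈? reachable i)

monoEdge? : ∀ {a b} (adj : BipGraph a b) (c : Colouring a b) κ u w → Dec (MonoEdge adj c κ u w)
monoEdge? adj c κ (inj₁ x) (inj₂ y) =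
  map′ (λ (e , col) → xy x y e col) (λ { (xy _ _ e col) → e , col }) (adj x y Bool.≟ true ×-dec c x y Bool.≟ κ)
monoEdge? adj c κ (inj₂ y) (inj₁ x) =
  map′ (λ (e , col) → yx x y e col) (λ { (yx _ _ e col) → e , col }) (adj x y Bool.≟ true ×-dec c x y Bool.≟ κ)
monoEdge? adj c κ (inj₁ _) (inj₁ _) = no λ ()
monoEdge? adj c κ (inj₂ _) (inj₂ _) = no λ ()

sameComp? : ∀ {a b} (adj : BipGraph a b) (c : Colouring a b) κ u w → Dec (SameComp adj c κ u w)
sameComp? {a} {b} adj c κ u w =
  map′ decode encode (reachable? (join a b u) (join a b w))
  where
  _⟶_ : Fin (a + b) → Fin (a + b) → Set
  i ⟶ j = MonoEdge adj c κ (splitAt a i) (splitAt a j)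
  open Reachability _⟶_ (λ i j → monoEdge? adj c κ (splitAt a i) (splitAt a j))

  encode : SameComp adj c κ u w → Star _⟶_ (join a b u) (join a b w)
  encode = gmap (join a b) λ {v} {v'} e → subst₂ (MonoEdge adj c κ) (sym (splitAt-join a b v)) (sym (splitAt-join a b v')) e

  decode : Star _⟶_ (join a b u) (join a b w) → SameComp adj c κ u w
  decode path = subst₂ (SameComp adj c κ) (splitAt-join a b u) (splitAt-join a b w) (gmap (splitAt a) (λ e → e) path)

compX : ∀ {a b} (adj : BipGraph a b) (c : Colouring a b) → Bool → Vertex a b → Subset a
compX adj c κ v = select (λ x → sameComp? adj c κ v (inj₁ x))

compY : ∀ {a b} (adj : BipGraph a b) (c : Colouring a b) → Bool → Vertex a b → Subset b
compY adj c κ v = select (λ y → sameComp? adj c κ v (inj₂ y))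

∈compX⁺ : ∀ {a b} {adj : BipGraph a b} {c κ v x} → SameComp adj c κ v (inj₁ x) → x ∈ compX adj c κ v
∈compX⁺ {adj = adj} {c} {κ} {v} = ∈-select⁺ (λ x → sameComp? adj c κ v (inj₁ x))

∈compX⁻ : ∀ {a b} {adj : BipGraph a b} {c κ v x} → x ∈ compX adj c κ v → SameComp adj c κ v (inj₁ x)
∈compX⁻ {adj = adj} {c} {κ} {v} = ∈-select⁻ (λ x → sameComp? adj c κ v (inj₁ x))

∈compY⁺ : ∀ {a b} {adj : BipGraph a b} {c κ v y} → SameComp adj c κ v (inj₂ y) → y ∈ compY adj c κ v
∈compY⁺ {adj = adj} {c} {κ} {v} = ∈-select⁺ (λ y → sameComp? adj c κ v (inj₂ y))

∈compY⁻ : ∀ {a b} {adj : BipGraph a b} {c κ v y} → y ∈ compY adj c κ v → SameComp adj c κ v (inj₂ y)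
∈compY⁻ {adj = adj} {c} {κ} {v} = ∈-select⁻ (λ y → sameComp? adj c κ v (inj₂ y))

transpose : ∀ {a b} → BipGraph a b → BipGraph b a
transpose adj y x = adj x y

untranspose : ∀ {a b} {adj : BipGraph a b} {c : Colouring a b} {κ u w} →
  SameComp (transpose adj) (transpose c) κ u w → SameComp adj c κ (swap u) (swap w)
untranspose = gmap swap λ { (xy y x e col) → yx x y e col ; (yx y x e col) → xy x y e col }

nbrs : ∀ {a b} → BipGraph a b → Fin a → Subset b
nbrs adj x = tabulate (adj x)

MonoPair : ∀ {a b} → BipGraph a b → Colouring a b → Bool → Subset a → Subset b → Set
MonoPair adj c μ S T = ∀ {x y} → x ∈ S → y ∈ T → adj x y ≡ true → c x y ≡ μ

Joined : ∀ {a b} → BipGraph a b → Colouring a b → Bool → Vertex a b → Subset a → Subset b → Set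
Joined adj c μ v S T =
  (∀ {x} → x ∈ S → SameComp adj c μ v (inj₁ x)) × (∀ {y} → y ∈ T → SameComp adj c μ v (inj₂ y))

unscale : ∀ d {p q m} → d * p ≤ m → m < d * q → p < q
unscale d {p} {q} dp≤m m<dq = *-cancelˡ-< d p q (≤-<-trans dp≤m m<dq)

-- In a bipartite graph where every vertex misses at most m/d vertices of the
-- other side, a monochromatic pair (S, T) with |S| > m/d and |T| > 2m/d is
-- contained in a single monochromatic component: two vertices of S have a
-- common neighbour in T, and every vertex of T has a neighbour in S.
module Dense {a b} (adj : BipGraph a b) (c : Colouring a b) (d m : ℕ)
  (sparseX : ∀ x → d * ∣ ∁ (nbrs adj x) ∣ ≤ m)
  (sparseY : ∀ y → d * ∣ ∁ (nbrs (transpose adj) y) ∣ ≤ m) where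

  common-neighbour : ∀ {T} x x' → 2 * m < d * ∣ T ∣ → ∃[ y ] (y ∈ T × adj x y ≡ true × adj x' y ≡ true)
  common-neighbour {T} x x' 2m<dT =
    let y , y∈         = meets T (nbrs adj x ∩ nbrs adj x') (unscale d few-non-common 2m<dT)
        y∈T , y∈N      = x∈p∩q⁻ T _ y∈
        xy∈E , x'y∈E   = x∈p∩q⁻ (nbrs adj x) _ y∈N
    in y , y∈T , ∈-tabulate⁻ xy∈E , ∈-tabulate⁻ x'y∈E
    where
    open ≤-Reasoning
    few-non-common : d * ∣ ∁ (nbrs adj x ∩ nbrs adj x') ∣ ≤ 2 * m
    few-non-common = begin
      d * ∣ ∁ (nbrs adj x ∩ nbrs adj x') ∣             ≤⟨ *-monoʳ-≤ d (∣∁p∩q∣≤ (nbrs adj x) (nbrs adj x')) ⟩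
      d * (∣ ∁ (nbrs adj x) ∣ + ∣ ∁ (nbrs adj x') ∣)     ≡⟨ *-distribˡ-+ d _ _ ⟩
      d * ∣ ∁ (nbrs adj x) ∣ + d * ∣ ∁ (nbrs adj x') ∣ ≤⟨ +-mono-≤ (sparseX x) (sparseX x') ⟩
      m + m                                           ≡⟨ cong (m +_) (+-identityʳ m) ⟨
      2 * m                                           ∎

  neighbour-in : ∀ {S} y → m < d * ∣ S ∣ → ∃[ x ] (x ∈ S × adj x y ≡ true)
  neighbour-in {S} y m<dS =
    let x , x∈      = meets S (nbrs (transpose adj) y) (unscale d (sparseY y) m<dS)
        x∈S , xy∈E  = x∈p∩q⁻ S _ x∈
    in x , x∈S , ∈-tabulate⁻ xy∈E

  linked : ∀ {μ S T x x'} → MonoPair adj c μ S T → 2 * m < d * ∣ T ∣ →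
           x ∈ S → x' ∈ S → SameComp adj c μ (inj₁ x) (inj₁ x')
  linked {x = x} {x'} mono 2m<dT x∈S x'∈S =
    let y , y∈T , e , e' = common-neighbour x x' 2m<dT
    in xy x y e (mono x∈S y∈T e) ◅ yx x' y e' (mono x'∈S y∈T e') ◅ ε

  joined : ∀ {μ S T} → MonoPair adj c μ S T → m < d * ∣ S ∣ → 2 * m < d * ∣ T ∣ →
           ∃[ x₀ ] Joined adj c μ (inj₁ x₀) S T
  joined {μ} {S} {T} mono m<dS 2m<dT =
    let x₀ , x₀∈S = size>0⇒nonempty S (unscale d (≤-reflexive (*-zeroʳ d)) (≤-<-trans z≤n m<dS))
    in x₀ , linked mono 2m<dT x₀∈S , to-T x₀∈S
    where
    to-T : ∀ {x₀ y} → x₀ ∈ S → y ∈ T → SameComp adj c μ (inj₁ x₀) (inj₂ y)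
    to-T {y = y} x₀∈S y∈T =
      let x , x∈S , e = neighbour-in y m<dS
      in linked mono 2m<dT x₀∈S x∈S ◅◅ (xy x y e (mono x∈S y∈T e) ◅ ε)

module DenseEither {a b} (adj : BipGraph a b) (c : Colouring a b) (d m : ℕ)
  (sparseX : ∀ x → d * ∣ ∁ (nbrs adj x) ∣ ≤ m)
  (sparseY : ∀ y → d * ∣ ∁ (nbrs (transpose adj) y) ∣ ≤ m) where

  untranspose-joined : ∀ {μ S T y₀} →
    Joined (transpose adj) (transpose c) μ (inj₁ y₀) T S → Joined adj c μ (inj₂ y₀) S T
  untranspose-joined {y₀ = y₀} (to-T , to-S) =
    (λ {x} x∈S → untranspose {u = inj₁ y₀} {w = inj₂ x} (to-S x∈S)) ,
    (λ {y} y∈T → untranspose {u = inj₁ y₀} {w = inj₁ y} (to-T y∈T))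

  joined : ∀ {μ S T} → MonoPair adj c μ S T →
           (m < d * ∣ S ∣ × 2 * m < d * ∣ T ∣) ⊎ (2 * m < d * ∣ S ∣ × m < d * ∣ T ∣) →
           ∃[ v ] Joined adj c μ v S T
  joined mono (inj₁ (hS , hT)) =
    let x₀ , joins = Dense.joined adj c d m sparseX sparseY mono hS hT
    in inj₁ x₀ , joins
  joined mono (inj₂ (hS , hT)) =
    let y₀ , joins = Dense.joined (transpose adj) (transpose c) d m sparseY sparseX (λ y∈T x∈S → mono x∈S y∈T) hT hS
    in inj₂ y₀ , untranspose-joined joins

∣tabulate∣≡sum : ∀ {k} (f : Fin k → Bool) → ∣ tabulate f ∣ ≡ sum (λ i → if f i then 1 else 0)
∣tabulate∣≡sum {zero} f = refl
∣tabulate∣≡sum {suc k} f with f zero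
... | true  = cong suc (∣tabulate∣≡sum (f ∘ suc))
... | false = ∣tabulate∣≡sum (f ∘ suc)

degree-sum : ∀ {a b} (adj : BipGraph a b) → sum (λ x → ∣ nbrs adj x ∣) ≡ sum (λ y → ∣ nbrs (transpose adj) y ∣)
degree-sum adj = begin
  sum (λ x → ∣ nbrs adj x ∣)                       ≡⟨ sum-cong-≗ (λ x → ∣tabulate∣≡sum (adj x)) ⟩
  sum (λ x → sum (λ y → if adj x y then 1 else 0)) ≡⟨ ∑-comm (λ x y → if adj x y then 1 else 0) ⟩
  sum (λ y → sum (λ x → if adj x y then 1 else 0)) ≡⟨ sum-cong-≗ (λ y → ∣tabulate∣≡sum (transpose adj y)) ⟨
  sum (λ y → ∣ nbrs (transpose adj) y ∣)           ∎
  where open ≡-Reasoning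

sum-lower : ∀ {k} d p (f : Fin k → ℕ) → (∀ i → p ≤ d * f i) → k * p ≤ d * sum f
sum-lower {zero}  d p f p≤ = z≤n
sum-lower {suc k} d p f p≤ = begin
  p + k * p                ≤⟨ +-mono-≤ (p≤ zero) (sum-lower d p (f ∘ suc) (p≤ ∘ suc)) ⟩
  d * f zero + d * sum (f ∘ suc) ≡⟨ *-distribˡ-+ d (f zero) _ ⟨
  d * sum f                ∎
  where open ≤-Reasoning

sum-upper : ∀ {k} d q (f : Fin k → ℕ) → (∀ i → d * f i ≤ q) → d * sum f ≤ k * q
sum-upper {zero}  d q f ≤q = ≤-reflexive (*-zeroʳ d)
sum-upper {suc k} d q f ≤q = begin
  d * sum f                ≡⟨ *-distribˡ-+ d (f zero) _ ⟩
  d * f zero + d * sum (f ∘ suc) ≤⟨ +-mono-≤ (≤q zero) (sum-upper d q (f ∘ suc) (≤q ∘ suc)) ⟩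
  q + k * q                ∎
  where open ≤-Reasoning

degree-bounds : ∀ {a b} (adj : BipGraph a b) d p q →
  (∀ x → p ≤ d * ∣ nbrs adj x ∣) → (∀ y → d * ∣ nbrs (transpose adj) y ∣ ≤ q) → a * p ≤ b * q
degree-bounds {a} {b} adj d p q p≤ ≤q = begin
  a * p                                    ≤⟨ sum-lower d p _ p≤ ⟩
  d * sum (λ x → ∣ nbrs adj x ∣)             ≡⟨ cong (d *_) (degree-sum adj) ⟩
  d * sum (λ y → ∣ nbrs (transpose adj) y ∣) ≤⟨ sum-upper d q _ ≤q ⟩
  b * q                                    ∎
  where open ≤-Reasoning

missing-few : ∀ {k} deg miss r → deg + miss ≡ k → 8 * k ≤ 8 * deg + r → 8 * miss ≤ r
missing-few {k} deg miss r split bound = +-cancelˡ-≤ (8 * deg) _ _ (begin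
  8 * deg + 8 * miss ≡⟨ *-distribˡ-+ 8 deg miss ⟨
  8 * (deg + miss)   ≡⟨ cong (8 *_) split ⟩
  8 * k              ≤⟨ bound ⟩
  8 * deg + r        ∎)
  where open ≤-Reasoning

two-parts : ∀ d p q r → d ≤ p + q → 8 * p ≤ r → 8 * q ≤ r → 8 * d ≤ 2 * r
two-parts d p q r d≤ p≤ q≤ = begin
  8 * d         ≤⟨ *-monoʳ-≤ 8 d≤ ⟩
  8 * (p + q)   ≡⟨ *-distribˡ-+ 8 p q ⟩
  8 * p + 8 * q ≤⟨ +-mono-≤ p≤ q≤ ⟩
  r + r         ≡⟨ cong (r +_) (+-identityʳ r) ⟨
  2 * r         ∎
  where open ≤-Reasoning

module Sizes (a b : ℕ) (a≤b : a ≤ b) (a-large : a + b < 4 * a) where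

  n : ℕ
  n = a + b

  half-X : ∀ s → a ≤ 2 * s → n < 8 * s
  half-X s a≤2s = <-≤-trans a-large (begin
    4 * a       ≤⟨ *-monoʳ-≤ 4 a≤2s ⟩
    4 * (2 * s) ≡⟨ *-assoc 4 2 s ⟨
    8 * s       ∎)
    where open ≤-Reasoning

  half-Y : ∀ t → b < 2 * t → 2 * n < 8 * t
  half-Y t b<2t = begin-strict
    2 * n         ≡⟨ *-distribˡ-+ 2 a b ⟩
    2 * a + 2 * b ≤⟨ +-monoˡ-≤ (2 * b) (*-monoʳ-≤ 2 a≤b) ⟩
    2 * b + 2 * b ≡⟨ *-distribʳ-+ b 2 2 ⟨
    4 * b         <⟨ *-monoʳ-< 4 b<2t ⟩
    4 * (2 * t)   ≡⟨ *-assoc 4 2 t ⟨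
    8 * t         ∎
    where open ≤-Reasoning

  -- Complementary to half-X: if the Y-part covers half of Y but at most n/4,
  -- then b ≤ a, so a set exceeding half of X exceeds n/4.
  either-dense : ∀ s t → a < 2 * s → b ≤ 2 * t →
                 (n < 8 * s × 2 * n < 8 * t) ⊎ (2 * n < 8 * s × n < 8 * t)
  either-dense s t a<2s b≤2t with 2 * n <? 8 * t
  ... | yes 2n<8t = inj₁ (half-X s (<⇒≤ a<2s) , 2n<8t)
  ... | no 2n≮8t  = inj₂ (2n<8s , n<8t)
    where
    open ≤-Reasoning
    4b≤8t : 4 * b ≤ 8 * t
    4b≤8t = begin
      4 * b       ≤⟨ *-monoʳ-≤ 4 b≤2t ⟩
      4 * (2 * t) ≡⟨ *-assoc 4 2 t ⟨
      8 * t       ∎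
    b≤a : 2 * b ≤ 2 * a
    b≤a = +-cancelʳ-≤ (2 * b) (2 * b) (2 * a) (begin
      2 * b + 2 * b ≡⟨ *-distribʳ-+ b 2 2 ⟨
      4 * b         ≤⟨ 4b≤8t ⟩
      8 * t         ≤⟨ ≮⇒≥ 2n≮8t ⟩
      2 * n         ≡⟨ *-distribˡ-+ 2 a b ⟩
      2 * a + 2 * b ∎)
    2n<8s : 2 * n < 8 * s
    2n<8s = begin-strict
      2 * n         ≡⟨ *-distribˡ-+ 2 a b ⟩
      2 * a + 2 * b ≤⟨ +-monoʳ-≤ (2 * a) b≤a ⟩
      2 * a + 2 * a ≡⟨ *-distribʳ-+ a 2 2 ⟨
      4 * a         <⟨ *-monoʳ-< 4 a<2s ⟩
      4 * (2 * s)   ≡⟨ *-assoc 4 2 s ⟨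
      8 * s         ∎
    n<8t : n < 8 * t
    n<8t = begin-strict
      n     <⟨ a-large ⟩
      4 * a ≤⟨ *-monoʳ-≤ 4 a≤b ⟩
      4 * b ≤⟨ 4b≤8t ⟩
      8 * t ∎

  X-small : ∀ dy → 8 * a ≤ 8 * dy + n → 8 * dy ≤ 2 * n → 8 * a ≤ 3 * n
  X-small dy bound dy≤ = begin
    8 * a      ≤⟨ bound ⟩
    8 * dy + n ≤⟨ +-monoˡ-≤ n dy≤ ⟩
    2 * n + n  ≡⟨ +-comm (2 * n) n ⟩
    3 * n      ∎
    where open ≤-Reasoning

  Y-small : ∀ dx → 8 * b ≤ 8 * dx + n → 8 * dx ≤ 2 * (2 * n) → 8 * b ≤ 5 * n
  Y-small dx bound dx≤ = begin
    8 * b            ≤⟨ bound ⟩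
    8 * dx + n       ≤⟨ +-monoˡ-≤ n dx≤ ⟩
    2 * (2 * n) + n  ≡⟨ cong (_+ n) (*-assoc 2 2 n) ⟨
    4 * n + n        ≡⟨ +-comm (4 * n) n ⟩
    5 * n            ∎
    where open ≤-Reasoning

  X-degree-large : ∀ dx → 8 * a ≤ 3 * n → 8 * b ≤ 8 * dx + n → 4 * n ≤ 8 * dx
  X-degree-large dx 8a≤3n bound = +-cancelʳ-≤ n (4 * n) (8 * dx) (begin
    4 * n + n  ≡⟨ +-comm (4 * n) n ⟩
    5 * n      ≤⟨ +-cancelʳ-≤ (3 * n) (5 * n) (8 * b) five-three ⟩
    8 * b      ≤⟨ bound ⟩
    8 * dx + n ∎)
    where
    open ≤-Reasoning
    five-three : 5 * n + 3 * n ≤ 8 * b + 3 * n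
    five-three = begin
      5 * n + 3 * n ≡⟨ *-distribʳ-+ n 5 3 ⟨
      8 * n         ≡⟨ *-distribˡ-+ 8 a b ⟩
      8 * a + 8 * b ≤⟨ +-monoˡ-≤ (8 * b) 8a≤3n ⟩
      3 * n + 8 * b ≡⟨ +-comm (3 * n) (8 * b) ⟩
      8 * b + 3 * n ∎

  0<a : 0 < a
  0<a = *-cancelˡ-< 4 0 a (≤-<-trans z≤n a-large)

  -- The double-counting bound a · n/2 ≤ b · n/4, i.e. 2a ≤ b, contradicts b ≤ 5n/8.
  degrees-contradict : a * (4 * n) ≤ b * (2 * n) → 8 * b ≤ 5 * n → ⊥
  degrees-contradict count 8b≤5n = contradiction 12a≤10a (<⇒≱ 10a<12a)
    where
    open ≤-Reasoning
    instance
      n≢0 : NonZero n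
      n≢0 = >-nonZero (<-≤-trans 0<a (m≤m+n a b))
    4a≤2b : 4 * a ≤ 2 * b
    4a≤2b = *-cancelʳ-≤ (4 * a) (2 * b) n (begin
      (4 * a) * n ≡⟨ factor a 4 ⟨
      a * (4 * n) ≤⟨ count ⟩
      b * (2 * n) ≡⟨ factor b 2 ⟩
      (2 * b) * n ∎)
      where
      factor : ∀ x k → x * (k * n) ≡ (k * x) * n
      factor x k = trans (sym (*-assoc x k n)) (cong (_* n) (*-comm x k))
    3b≤5a : 3 * b ≤ 5 * a
    3b≤5a = +-cancelʳ-≤ (5 * b) (3 * b) (5 * a) (begin
      3 * b + 5 * b ≡⟨ *-distribʳ-+ b 3 5 ⟨
      8 * b         ≤⟨ 8b≤5n ⟩
      5 * n         ≡⟨ *-distribˡ-+ 5 a b ⟩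
      5 * a + 5 * b ∎)
    12a≤10a : 12 * a ≤ 10 * a
    12a≤10a = begin
      12 * a      ≡⟨ *-assoc 3 4 a ⟩
      3 * (4 * a) ≤⟨ *-monoʳ-≤ 3 4a≤2b ⟩
      3 * (2 * b) ≡⟨ *-assoc 3 2 b ⟨
      6 * b       ≡⟨ *-assoc 2 3 b ⟩
      2 * (3 * b) ≤⟨ *-monoʳ-≤ 2 3b≤5a ⟩
      2 * (5 * a) ≡⟨ *-assoc 2 5 a ⟨
      10 * a      ∎
    10a<12a : 10 * a < 12 * a
    10a<12a = begin-strict
      10 * a         <⟨ m<m+n (10 * a) (*-monoʳ-< 2 0<a) ⟩
      10 * a + 2 * a ≡⟨ *-distribʳ-+ a 10 2 ⟨
      12 * a         ∎

module LargeComponent {a b} (adj : BipGraph a b) (c : Colouring a b)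
  (a≤b : a ≤ b) (a-large : a + b < 4 * a)
  (hX : ∀ x → 8 * b ≤ 8 * degX adj x + (a + b))
  (hY : ∀ y → 8 * a ≤ 8 * degY adj y + (a + b)) where

  open Sizes a b a≤b a-large

  Goal : Set
  Goal = ∃[ κ ] ∃[ v ] ∃[ SX ] ∃[ SY ]
    ((∀ x → x ∈ SX → SameComp adj c κ v (inj₁ x)) ×
     (∀ y → y ∈ SY → SameComp adj c κ v (inj₂ y)) ×
     a ≤ 2 * ∣ SX ∣ × b ≤ 2 * ∣ SY ∣)

  CX : Bool → Vertex a b → Subset a
  CX = compX adj c

  CY : Bool → Vertex a b → Subset b
  CY = compY adj c

  found : ∀ κ v → a ≤ 2 * ∣ CX κ v ∣ → b ≤ 2 * ∣ CY κ v ∣ → Goal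
  found κ v ha hb = κ , v , CX κ v , CY κ v , (λ _ → ∈compX⁻) , (λ _ → ∈compY⁻) , ha , hb

  sparseX : ∀ x → 8 * ∣ ∁ (nbrs adj x) ∣ ≤ n
  sparseX x = missing-few (degX adj x) ∣ ∁ (nbrs adj x) ∣ n (∣p∣+∣∁p∣≡k (nbrs adj x)) (hX x)

  sparseY : ∀ y → 8 * ∣ ∁ (nbrs (transpose adj) y) ∣ ≤ n
  sparseY y = missing-few (degY adj y) ∣ ∁ (nbrs (transpose adj) y) ∣ n (∣p∣+∣∁p∣≡k (nbrs (transpose adj) y)) (hY y)

  absorbed : ∀ {μ S T} → MonoPair adj c μ S T →
    (n < 8 * ∣ S ∣ × 2 * n < 8 * ∣ T ∣) ⊎ (2 * n < 8 * ∣ S ∣ × n < 8 * ∣ T ∣) →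
    ∃[ v ] (∣ S ∣ ≤ ∣ CX μ v ∣ × ∣ T ∣ ≤ ∣ CY μ v ∣)
  absorbed mono dense =
    let v , to-S , to-T = DenseEither.joined adj c 8 n sparseX sparseY mono dense
    in v , p⊆q⇒∣p∣≤∣q∣ (∈compX⁺ ∘ to-S) , p⊆q⇒∣p∣≤∣q∣ (∈compY⁺ ∘ to-T)

  leave-X : ∀ κ v → MonoPair adj c (not κ) (∁ (CX κ v)) (CY κ v)
  leave-X κ v {x} {y} x∉C y∈C e =
    Bool.¬-not λ col → x∈∁p⇒x∉p x∉C (∈compX⁺ {v = v} (∈compY⁻ y∈C ◅◅ (yx x y e col ◅ ε)))

  leave-Y : ∀ κ v → MonoPair adj c (not κ) (CX κ v) (∁ (CY κ v))
  leave-Y κ v {x} {y} x∈C y∉C e =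
    Bool.¬-not λ col → x∈∁p⇒x∉p y∉C (∈compY⁺ {v = v} (∈compX⁻ x∈C ◅◅ (xy x y e col ◅ ε)))

  -- A component containing half of Y: if it misses more than half of X, the
  -- missed part of X and its Y-part form a dense pair of the other colour.
  from-half-Y : ∀ κ v → b ≤ 2 * ∣ CY κ v ∣ → Goal
  from-half-Y κ v hb = by-X-part (a ≤? 2 * ∣ CX κ v ∣)
    where
    by-X-part : Dec (a ≤ 2 * ∣ CX κ v ∣) → Goal
    by-X-part (yes ha) = found κ v ha hb
    by-X-part (no ¬ha) =
      let a<2S         = complement-large (CX κ v) ¬ha
          v' , S≤ , T≤ = absorbed (leave-X κ v) (either-dense ∣ ∁ (CX κ v) ∣ ∣ CY κ v ∣ a<2S hb)
      in found (not κ) v' (≤-trans (<⇒≤ a<2S) (*-monoʳ-≤ 2 S≤)) (≤-trans hb (*-monoʳ-≤ 2 T≤))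

  from-X : ∀ κ v → n < 8 * ∣ CX κ v ∣ → Goal
  from-X κ v hx = by-Y-part (b ≤? 2 * ∣ CY κ v ∣)
    where
    by-Y-part : Dec (b ≤ 2 * ∣ CY κ v ∣) → Goal
    by-Y-part (yes hb) = from-half-Y κ v hb
    by-Y-part (no ¬hb) =
      let b<2T        = complement-large (CY κ v) ¬hb
          v' , _ , T≤ = absorbed (leave-Y κ v) (inj₁ (hx , half-Y ∣ ∁ (CY κ v) ∣ b<2T))
      in from-half-Y (not κ) v' (≤-trans (<⇒≤ b<2T) (*-monoʳ-≤ 2 T≤))

  from-Y : ∀ κ v → 2 * n < 8 * ∣ CY κ v ∣ → Goal
  from-Y κ v hy = by-X-part (a ≤? 2 * ∣ CX κ v ∣)
    where
    by-X-part : Dec (a ≤ 2 * ∣ CX κ v ∣) → Goal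
    by-X-part (yes ha) = from-X κ v (half-X ∣ CX κ v ∣ ha)
    by-X-part (no ¬ha) =
      let a<2S        = complement-large (CX κ v) ¬ha
          v' , S≤ , _ = absorbed (leave-X κ v) (inj₁ (half-X ∣ ∁ (CX κ v) ∣ (<⇒≤ a<2S) , hy))
      in from-X (not κ) v' (half-X ∣ CX (not κ) v' ∣ (≤-trans (<⇒≤ a<2S) (*-monoʳ-≤ 2 S≤)))

  nbrs-X-split : ∀ x → nbrs adj x ⊆ CY true (inj₁ x) ∪ CY false (inj₁ x)
  nbrs-X-split x {y} y∈N = x∈p∪q⁺ (by-colour (c x y) refl)
    where
    by-colour : ∀ κ → c x y ≡ κ → y ∈ CY true (inj₁ x) ⊎ y ∈ CY false (inj₁ x)
    by-colour true  col = inj₁ (∈compY⁺ (xy x y (∈-tabulate⁻ y∈N) col ◅ ε))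
    by-colour false col = inj₂ (∈compY⁺ (xy x y (∈-tabulate⁻ y∈N) col ◅ ε))

  nbrs-Y-split : ∀ y → nbrs (transpose adj) y ⊆ CX true (inj₂ y) ∪ CX false (inj₂ y)
  nbrs-Y-split y {x} x∈N = x∈p∪q⁺ (by-colour (c x y) refl)
    where
    by-colour : ∀ κ → c x y ≡ κ → x ∈ CX true (inj₂ y) ⊎ x ∈ CX false (inj₂ y)
    by-colour true  col = inj₁ (∈compX⁺ (yx x y (∈-tabulate⁻ x∈N) col ◅ ε))
    by-colour false col = inj₂ (∈compX⁺ (yx x y (∈-tabulate⁻ x∈N) col ◅ ε))

  degree-Y : ∀ y → Goal ⊎ 8 * degY adj y ≤ 2 * n
  degree-Y y = by-size (n <? 8 * ∣ CX true (inj₂ y) ∣) (n <? 8 * ∣ CX false (inj₂ y) ∣)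
    where
    by-size : Dec (n < 8 * ∣ CX true (inj₂ y) ∣) → Dec (n < 8 * ∣ CX false (inj₂ y) ∣) →
              Goal ⊎ 8 * degY adj y ≤ 2 * n
    by-size (yes big) _         = inj₁ (from-X true (inj₂ y) big)
    by-size (no _)    (yes big) = inj₁ (from-X false (inj₂ y) big)
    by-size (no s₁)   (no s₂)   = inj₂ (two-parts (degY adj y) ∣ CX true (inj₂ y) ∣ ∣ CX false (inj₂ y) ∣ n
                                          (cover (nbrs-Y-split y)) (≮⇒≥ s₁) (≮⇒≥ s₂))

  degree-X : ∀ x → Goal ⊎ 8 * degX adj x ≤ 2 * (2 * n)
  degree-X x = by-size (2 * n <? 8 * ∣ CY true (inj₁ x) ∣) (2 * n <? 8 * ∣ CY false (inj₁ x) ∣)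
    where
    by-size : Dec (2 * n < 8 * ∣ CY true (inj₁ x) ∣) → Dec (2 * n < 8 * ∣ CY false (inj₁ x) ∣) →
              Goal ⊎ 8 * degX adj x ≤ 2 * (2 * n)
    by-size (yes big) _         = inj₁ (from-Y true (inj₁ x) big)
    by-size (no _)    (yes big) = inj₁ (from-Y false (inj₁ x) big)
    by-size (no s₁)   (no s₂)   = inj₂ (two-parts (degX adj x) ∣ CY true (inj₁ x) ∣ ∣ CY false (inj₁ x) ∣ (2 * n)
                                          (cover (nbrs-X-split x)) (≮⇒≥ s₁) (≮⇒≥ s₂))

  -- Such small degrees contradict the minimum-degree conditions: they force
  -- a ≤ 3n/8 and b ≤ 5n/8, hence all X-degrees ≥ n/2, and double counting the
  -- edges then gives 2a ≤ b.
  small-degrees-impossible : (∀ x → 8 * degX adj x ≤ 2 * (2 * n)) → (∀ y → 8 * degY adj y ≤ 2 * n) → ⊥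
  small-degrees-impossible Hx Hy =
    degrees-contradict (degree-bounds adj 8 (4 * n) (2 * n) X-degrees-large Hy) (Y-small (degX adj x₀) (hX x₀) (Hx x₀))
    where
    x₀ : Fin a
    x₀ = fromℕ< 0<a
    y₀ : Fin b
    y₀ = fromℕ< (<-≤-trans 0<a a≤b)
    X-degrees-large : ∀ x → 4 * n ≤ 8 * degX adj x
    X-degrees-large x = X-degree-large (degX adj x) (X-small (degY adj y₀) (hY y₀) (Hy y₀)) (hX x)

theorem7 : (a b : ℕ) (adj : BipGraph a b) →
    a ≤ b →
    a + b < 4 * a →
    (∀ x → 8 * b ≤ 8 * degX adj x + (a + b)) →
    (∀ y → 8 * a ≤ 8 * degY adj y + (a + b)) →
    (c : Colouring a b) →
    ∃[ κ ] ∃[ v ] ∃[ SX ] ∃[ SY ]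
      ((∀ x → x ∈ SX → SameComp adj c κ v (inj₁ x)) ×
       (∀ y → y ∈ SY → SameComp adj c κ v (inj₂ y)) ×
       a ≤ 2 * ∣ SX ∣ × b ≤ 2 * ∣ SY ∣)
theorem7 a b adj a≤b a-large hX hY c = conclude (first-or-all degree-X) (first-or-all degree-Y)
  where
  open LargeComponent adj c a≤b a-large hX hY
  conclude : Goal ⊎ (∀ x → 8 * degX adj x ≤ 2 * (2 * (a + b))) →
             Goal ⊎ (∀ y → 8 * degY adj y ≤ 2 * (a + b)) → Goal
  conclude (inj₁ goal) _           = goal
  conclude (inj₂ _)    (inj₁ goal) = goal
  conclude (inj₂ Hx)   (inj₂ Hy)   = ⊥-elim (small-degrees-impossible Hx Hy)
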